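{- Let $d$ be a positive integer and let $P_1, P_2\subseteq \mathbb{N}$ be finite nonempty arithmetic progressions with the same common difference $d$, i.e. $P_1=\{a, a+d, a+2d,\ldots,a+kd\}$ and $P_2=\{b,b+d,b+2d,\ldots,b+\ell d\}$ for some $a,b,k,\ell\in\mathbb{N}$. Then $P_1\cup P_2$ is not sum-dominant, i.e. $|(P_1\cup P_2)+(P_1\cup P_2)|\le |(P_1\cup P_2)-(P_1\cup P_2)|$.
   Context: For a finite set $A\subseteq\mathbb{N}$, define the sum set $A+A=\{a_i+a_j : a_i,a_j\in A\}$ and the difference set $A-A=\{a_i-a_j : a_i,a_j\in A\}$. The set $A$ is called sum-dominant if $|A+A|>|A-A|$. -}

module Defs where

open import Data.Nat using (ℕ; suc; _+_; _*_)
import Data.Nat as ℕ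
open import Data.Integer using (ℤ; +_; _-_)
import Data.Integer as ℤ
open import Data.List using (List; map; upTo; length; deduplicate; cartesianProductWith; _++_)

-- Finite subsets of ℕ (resp. ℤ) are represented by lists of their elements
-- (repetitions allowed); the cardinality of the represented set is the length
-- of the list after removing duplicates.
cardℕ : List ℕ → ℕ
cardℕ xs = length (deduplicate ℕ._≟_ xs)

cardℤ : List ℤ → ℕ
cardℤ xs = length (deduplicate ℤ._≟_ xs)

sumset : List ℕ → List ℕ
sumset A = cartesianProductWith _+_ A A

diffset : List ℕ → List ℤ
diffset A = cartesianProductWith (λ x y → + x - + y) A A

AP : ℕ → ℕ → ℕ → List ℕ
AP a d k = map (λ i → a + i * d) (upTo (suc k))

SumDominant : List ℕ → Set
SumDominant A = cardℤ (diffset A) ℕ.< cardℕ (sumset A)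

module Submission where

-- Write P₁ = {a + i d : i ≤ k}, P₂ = {b + j d : j ≤ ℓ}, A = P₁ ∪ P₂, and by
-- symmetry assume ℓ ≤ k.  We inject A + A into A − A.  Split A + A into
-- L = P₁ + A and its complement, which lies in P₂ + P₂.  On L use the
-- translation  s ↦ s − t  with t = 2a + kd the centre of P₁ + P₁: it sends
-- (a + id) + y to y − (a + (k − i)d) ∈ A − P₁.  On the complement use the
-- reflection  s ↦ c − s  with c = a + b + ed, where e = ℓ if a ≤ b and e = k
-- otherwise: it sends (b + id) + (b + jd) to (a + (e − j)d) − (b + id).
-- Both maps are injective, and their images are disjoint: if s − t = c − s'
-- with s ∈ L and s' ∈ P₂ + P₂, then s' = (c + t) − s lies in
-- (P₁ + P₁) ∪ (P₁ + P₂) ⊆ L again; this is where the choice of e matters.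

open import Defs
open import Data.Nat using (ℕ; _≤_; _<_)
open import Data.List using (_++_)
open import Relation.Nullary using (¬_)
open import Data.Product using (_×_)

open import Data.Nat using (suc; _+_; _*_; _∸_; z≤n; s≤s; s≤s⁻¹; NonZero; >-nonZero; _≤?_)
import Data.Nat as ℕ
open import Data.Nat.Properties
open import Data.Nat.Tactic.RingSolver using (solve-∀)
open import Data.Integer using (ℤ; +_; _-_; _⊖_)
import Data.Integer as ℤ
import Data.Integer.Properties as ℤ
import Data.Integer.Tactic.RingSolver as ℤ-Solver
open import Data.List using (List; []; _∷_; map; length; deduplicate; cartesianProductWith; upTo)
open import Data.List.Properties using (length-++; length-map)
open import Data.List.Membership.Propositional using (_∈_)
open import Data.List.Membership.Propositional.Properties
open import Data.List.Membership.DecPropositional ℕ._≟_ using (_∈?_)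
open import Data.List.Relation.Binary.Subset.Propositional using (_⊆_)
open import Data.List.Relation.Binary.Subset.Propositional.Properties using (⊆-reflexive-↭)
open import Data.List.Relation.Binary.Permutation.Propositional.Properties using (++-comm)
open import Data.List.Relation.Unary.Any using (here; there)
import Data.List.Relation.Unary.All as All
import Data.List.Relation.Unary.All.Properties as All
open import Data.List.Relation.Unary.AllPairs using ([]; _∷_)
open import Data.List.Relation.Unary.Unique.Propositional using (Unique)
open import Data.List.Relation.Unary.Unique.DecPropositional.Properties using (deduplicate-!)
open import Data.Product using (_,_; ∃; ∃₂)
open import Data.Sum using (_⊎_; inj₁; inj₂)
open import Data.Empty using (⊥-elim)
open import Function using (id)
open import Relation.Nullary using (Dec; yes; no)
open import Relation.Binary.Definitions using (DecidableEquality)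
open import Relation.Binary.PropositionalEquality

InjectiveOn : {A B : Set} → (A → B) → List A → Set
InjectiveOn f xs = ∀ {x y} → x ∈ xs → y ∈ xs → f x ≡ f y → x ≡ y

unique-⊆⇒length-≤ : {A : Set} {xs ys : List A} → Unique xs → xs ⊆ ys → length xs ≤ length ys
unique-⊆⇒length-≤ {xs = []} _ _ = z≤n
unique-⊆⇒length-≤ {xs = x ∷ xs} (x∉xs ∷ xs!) x∷xs⊆ys
  with ys₁ , ys₂ , refl ← ∈-∃++ (x∷xs⊆ys (here refl)) = begin
    suc (length xs)                ≤⟨ s≤s (unique-⊆⇒length-≤ xs! xs⊆ys₁++ys₂) ⟩
    suc (length (ys₁ ++ ys₂))      ≡⟨ cong suc (length-++ ys₁) ⟩
    suc (length ys₁ + length ys₂)  ≡⟨ +-suc (length ys₁) (length ys₂) ⟨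
    length ys₁ + length (x ∷ ys₂)  ≡⟨ length-++ ys₁ ⟨
    length (ys₁ ++ x ∷ ys₂)        ∎
  where
  open ≤-Reasoning
  xs⊆ys₁++ys₂ : xs ⊆ ys₁ ++ ys₂
  xs⊆ys₁++ys₂ z∈xs with ∈-++⁻ ys₁ (x∷xs⊆ys (there z∈xs))
  ... | inj₁ z∈ys₁         = ∈-++⁺ˡ z∈ys₁
  ... | inj₂ (here refl)   = ⊥-elim (All.lookup x∉xs z∈xs refl)
  ... | inj₂ (there z∈ys₂) = ∈-++⁺ʳ ys₁ z∈ys₂

map-unique : {A B : Set} (f : A → B) {xs : List A} → Unique xs → InjectiveOn f xs → Unique (map f xs)
map-unique f []             _   = []
map-unique f (x∉xs ∷ xs!) inj =
  All.map⁺ (All.tabulate λ y∈xs fx≡fy → All.lookup x∉xs y∈xs (inj (here refl) (there y∈xs) fx≡fy))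
  ∷ map-unique f xs! (λ p q → inj (there p) (there q))

distinct-≤ : {A B : Set} (_≟ᴬ_ : DecidableEquality A) (_≟ᴮ_ : DecidableEquality B)
  (f : A → B) {xs : List A} {ys : List B} →
  InjectiveOn f xs → (∀ {x} → x ∈ xs → f x ∈ ys) →
  length (deduplicate _≟ᴬ_ xs) ≤ length (deduplicate _≟ᴮ_ ys)
distinct-≤ _≟ᴬ_ _≟ᴮ_ f {xs} {ys} inj into = begin
  length xs′                      ≡⟨ length-map f xs′ ⟨
  length (map f xs′)              ≤⟨ unique-⊆⇒length-≤ (map-unique f (deduplicate-! _≟ᴬ_ xs) inj′) image⊆ ⟩
  length (deduplicate _≟ᴮ_ ys)    ∎
  where
  open ≤-Reasoning
  xs′ : List _
  xs′ = deduplicate _≟ᴬ_ xs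
  inj′ : InjectiveOn f xs′
  inj′ p q = inj (∈-deduplicate⁻ _≟ᴬ_ xs p) (∈-deduplicate⁻ _≟ᴬ_ xs q)
  image⊆ : map f xs′ ⊆ deduplicate _≟ᴮ_ ys
  image⊆ z∈ with x , x∈ , refl ← ∈-map⁻ f z∈ = ∈-deduplicate⁺ _≟ᴮ_ (into (∈-deduplicate⁻ _≟ᴬ_ xs x∈))

cardℕ-mono : {S S′ : List ℕ} → S ⊆ S′ → cardℕ S ≤ cardℕ S′
cardℕ-mono = distinct-≤ ℕ._≟_ ℕ._≟_ id (λ _ _ eq → eq)

cardℤ-mono : {S S′ : List ℤ} → S ⊆ S′ → cardℤ S ≤ cardℤ S′
cardℤ-mono = distinct-≤ ℤ._≟_ ℤ._≟_ id (λ _ _ eq → eq)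

cartesianProductWith-mono : {A B C : Set} (f : A → B → C) {xs xs′ : List A} {ys ys′ : List B} →
  xs ⊆ xs′ → ys ⊆ ys′ → cartesianProductWith f xs ys ⊆ cartesianProductWith f xs′ ys′
cartesianProductWith-mono f {xs} {ys = ys} xs⊆ ys⊆ z∈
  with x , y , x∈ , y∈ , refl ← ∈-cartesianProductWith⁻ f xs ys z∈ =
  ∈-cartesianProductWith⁺ f (xs⊆ x∈) (ys⊆ y∈)

sumset-mono : {A B : List ℕ} → A ⊆ B → sumset A ⊆ sumset B
sumset-mono A⊆B = cartesianProductWith-mono _+_ A⊆B A⊆B

diffset-mono : {A B : List ℕ} → A ⊆ B → diffset A ⊆ diffset B
diffset-mono A⊆B = cartesianProductWith-mono (λ x y → + x - + y) A⊆B A⊆B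

diff-≡ : ∀ u v z w → u + w ≡ z + v → + u - + v ≡ + z - + w
diff-≡ u v z w eq = begin
  + u - + v             ≡⟨ ℤ.[+m]-[+n]≡m⊖n u v ⟩
  u ⊖ v                 ≡⟨ ℤ.+-cancelˡ-⊖ w u v ⟨
  (w + u) ⊖ (w + v)     ≡⟨ cong₂ _⊖_ (trans (+-comm w u) (trans eq (+-comm z v))) (+-comm w v) ⟩
  (v + z) ⊖ (v + w)     ≡⟨ ℤ.+-cancelˡ-⊖ v z w ⟩
  z ⊖ w                 ≡⟨ ℤ.[+m]-[+n]≡m⊖n z w ⟨
  + z - + w             ∎
  where open ≡-Reasoning

diff-≡⁻ : ∀ u v z w → + u - + v ≡ + z - + w → u + w ≡ z + v
diff-≡⁻ u v z w eq = ℤ.+-injective (begin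
  + (u + w)                         ≡⟨ ℤ.pos-+ u w ⟩
  + u ℤ.+ + w                       ≡⟨ sub-add (+ u) (+ v) (+ w) ⟨
  (+ u - + v) ℤ.+ (+ v ℤ.+ + w)     ≡⟨ cong₂ ℤ._+_ eq (ℤ.+-comm (+ v) (+ w)) ⟩
  (+ z - + w) ℤ.+ (+ w ℤ.+ + v)     ≡⟨ sub-add (+ z) (+ w) (+ v) ⟩
  + z ℤ.+ + v                       ≡⟨ ℤ.pos-+ z v ⟨
  + (z + v)                         ∎)
  where
  open ≡-Reasoning
  sub-add : ∀ (x y t : ℤ) → (x - y) ℤ.+ (y ℤ.+ t) ≡ x ℤ.+ t
  sub-add = ℤ-Solver.solve-∀

∈-AP⁻ : ∀ {a d k z} → z ∈ AP a d k → ∃ λ i → i ≤ k × z ≡ a + i * d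
∈-AP⁻ {a} {d} {k} z∈ with i , i∈ , refl ← ∈-map⁻ (λ i → a + i * d) {xs = upTo (suc k)} z∈ =
  i , s≤s⁻¹ (∈-upTo⁻ i∈) , refl

∈-AP⁺ : ∀ {a d k i} → i ≤ k → a + i * d ∈ AP a d k
∈-AP⁺ {a} {d} i≤k = ∈-map⁺ (λ i → a + i * d) (∈-upTo⁺ (s≤s i≤k))

AP-term-sum : ∀ a b d i j → (a + i * d) + (b + j * d) ≡ a + b + (i + j) * d
AP-term-sum = solve-∀

AP+AP⊆AP : ∀ {a b d k ℓ x y} → x ∈ AP a d k → y ∈ AP b d ℓ → x + y ∈ AP (a + b) d (k + ℓ)
AP+AP⊆AP {a} {b} {d} {k} {ℓ} x∈ y∈ with i , i≤ , refl ← ∈-AP⁻ x∈ | j , j≤ , refl ← ∈-AP⁻ y∈ =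
  subst (_∈ AP (a + b) d (k + ℓ)) (sym (AP-term-sum a b d i j)) (∈-AP⁺ {a + b} {d} (+-mono-≤ i≤ j≤))

split-index : ∀ {k ℓ} r → r ≤ k + ℓ → ∃₂ λ i j → i ≤ k × j ≤ ℓ × i + j ≡ r
split-index {k} r r≤ with r ≤? k
... | yes r≤k = r , 0 , r≤k , z≤n , +-identityʳ r
... | no  r≰k = k , r ∸ k , ≤-refl , m≤n+o⇒m∸n≤o r k r≤ , m+[n∸m]≡n (≰⇒≥ r≰k)

AP⊆AP+AP : ∀ {a b d k ℓ z} → z ∈ AP (a + b) d (k + ℓ) → z ∈ cartesianProductWith _+_ (AP a d k) (AP b d ℓ)
AP⊆AP+AP {a} {b} {d} {k} {ℓ} z∈
  with r , r≤ , refl ← ∈-AP⁻ z∈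
  with i , j , i≤k , j≤ℓ , refl ← split-index {k} {ℓ} r r≤ =
  subst (_∈ cartesianProductWith _+_ (AP a d k) (AP b d ℓ)) (AP-term-sum a b d i j)
    (∈-cartesianProductWith⁺ _+_ (∈-AP⁺ {a} {d} {k} {i} i≤k) (∈-AP⁺ {b} {d} {ℓ} {j} j≤ℓ))

index-≤ : ∀ {x y m n d} .{{_ : NonZero d}} → x ≤ y → x + m * d ≡ y + n * d → n ≤ m
index-≤ {x} {y} {m} {n} {d} x≤y eq = *-cancelʳ-≤ n m d (+-cancelˡ-≤ y (n * d) (m * d) (begin
  y + n * d  ≡⟨ eq ⟨
  x + m * d  ≤⟨ +-monoˡ-≤ (m * d) x≤y ⟩
  y + m * d  ∎))
  where open ≤-Reasoning

drop-steps : ∀ {x y P T N d} → P ≤ N → x + (P + T) * d ≡ y + N * d → x + T * d ≡ y + (N ∸ P) * d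
drop-steps {x} {y} {P} {T} {N} {d} P≤N eq = +-cancelˡ-≡ (P * d) _ _ (begin
  P * d + (x + T * d)        ≡⟨ pull P d x T ⟩
  x + (P + T) * d            ≡⟨ eq ⟩
  y + N * d                  ≡⟨ cong (λ n → y + n * d) (m+[n∸m]≡n P≤N) ⟨
  y + (P + (N ∸ P)) * d      ≡⟨ pull P d y (N ∸ P) ⟨
  P * d + (y + (N ∸ P) * d)  ∎)
  where
  open ≡-Reasoning
  pull : ∀ P d z t → P * d + (z + t * d) ≡ z + (P + t) * d
  pull = solve-∀

-- The parameter e (ℓ ≤ e ≤ k) is
-- the pivot of the reflection; `order` records the choice e = ℓ when a ≤ b
-- and e = k when b ≤ a, which is what makes the two images disjoint.

module Injection (d a b k ℓ e : ℕ) .{{_ : NonZero d}} (ℓ≤e : ℓ ≤ e) (e≤k : e ≤ k)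
                 (order : (a ≤ b × e ≤ ℓ) ⊎ (b ≤ a × k ≤ e)) where

  P₁ P₂ A : List ℕ
  P₁ = AP a d k
  P₂ = AP b d ℓ
  A  = P₁ ++ P₂

  L : List ℕ
  L = cartesianProductWith _+_ P₁ A

  -- translation constant t (the centre of P₁ + P₁) and reflection centre c
  t c : ℕ
  t = a + a + k * d
  c = a + b + e * d

  P₁+P₁⊆L : ∀ {s} → s ∈ AP (a + a) d (k + k) → s ∈ L
  P₁+P₁⊆L s∈ = cartesianProductWith-mono _+_ {P₁} {P₁} {P₁} {A} id ∈-++⁺ˡ (AP⊆AP+AP {a} {a} {d} {k} {k} s∈)

  P₁+P₂⊆L : ∀ {s} → s ∈ AP (a + b) d (k + ℓ) → s ∈ L
  P₁+P₂⊆L s∈ = cartesianProductWith-mono _+_ {P₁} {P₁} {P₂} {A} id (∈-++⁺ʳ P₁) (AP⊆AP+AP {a} {b} {d} {k} {ℓ} s∈)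

  L⊆P₁+A : ∀ {s} → s ∈ L → s ∈ AP (a + a) d (k + k) ⊎ s ∈ AP (a + b) d (k + ℓ)
  L⊆P₁+A s∈ with x , y , x∈ , y∈ , refl ← ∈-cartesianProductWith⁻ _+_ P₁ A s∈ with ∈-++⁻ P₁ y∈
  ... | inj₁ y∈P₁ = inj₁ (AP+AP⊆AP x∈ y∈P₁)
  ... | inj₂ y∈P₂ = inj₂ (AP+AP⊆AP x∈ y∈P₂)

  P₂+P₂⊆AP : ∀ {s} → s ∈ cartesianProductWith _+_ P₂ P₂ → s ∈ AP (b + b) d (ℓ + ℓ)
  P₂+P₂⊆AP s∈ with x , y , x∈ , y∈ , refl ← ∈-cartesianProductWith⁻ _+_ P₂ P₂ s∈ = AP+AP⊆AP x∈ y∈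

  outside-L : ∀ {s} → s ∈ sumset A → ¬ s ∈ L → s ∈ cartesianProductWith _+_ P₂ P₂
  outside-L s∈ s∉L with x , y , x∈ , y∈ , refl ← ∈-cartesianProductWith⁻ _+_ A A s∈
                     with ∈-++⁻ P₁ x∈ | ∈-++⁻ P₁ y∈
  ... | inj₁ x∈P₁ | _         = ⊥-elim (s∉L (∈-cartesianProductWith⁺ _+_ x∈P₁ y∈))
  ... | inj₂ _    | inj₁ y∈P₁ = ⊥-elim (s∉L (subst (_∈ L) (+-comm y x) (∈-cartesianProductWith⁺ _+_ y∈P₁ x∈)))
  ... | inj₂ x∈P₂ | inj₂ y∈P₂ = ∈-cartesianProductWith⁺ _+_ x∈P₂ y∈P₂

  -- (a + id) + y − t = y − (a + (k − i)d)
  translate∈ : ∀ {s} → s ∈ L → + s - + t ∈ diffset A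
  translate∈ s∈ with x , y , x∈ , y∈ , refl ← ∈-cartesianProductWith⁻ _+_ P₁ A s∈
                 with i , i≤k , refl ← ∈-AP⁻ x∈ =
    subst (_∈ diffset A) (sym (diff-≡ _ t y _ balance))
      (∈-cartesianProductWith⁺ (λ x y → + x - + y) y∈ (∈-++⁺ˡ (∈-AP⁺ (m∸n≤m k i))))
    where
    balance : (a + i * d + y) + (a + (k ∸ i) * d) ≡ y + t
    balance = trans (regroup a i (k ∸ i) y d) (cong (λ n → y + (a + a + n * d)) (m+[n∸m]≡n i≤k))
      where
      regroup : ∀ a i r y d → (a + i * d + y) + (a + r * d) ≡ y + (a + a + (i + r) * d)
      regroup = solve-∀

  -- c − ((b + id) + (b + jd)) = (a + (e − j)d) − (b + id)
  reflect∈ : ∀ {s} → s ∈ cartesianProductWith _+_ P₂ P₂ → + c - + s ∈ diffset A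
  reflect∈ s∈ with x , y , x∈ , y∈ , refl ← ∈-cartesianProductWith⁻ _+_ P₂ P₂ s∈
               with i , _ , refl ← ∈-AP⁻ x∈ | j , j≤ℓ , refl ← ∈-AP⁻ y∈ =
    subst (_∈ diffset A) (sym (diff-≡ c _ _ _ balance))
      (∈-cartesianProductWith⁺ (λ x y → + x - + y) (∈-++⁺ˡ (∈-AP⁺ (≤-trans (m∸n≤m e j) e≤k))) (∈-++⁺ʳ P₁ x∈))
    where
    balance : c + (b + i * d) ≡ (a + (e ∸ j) * d) + ((b + i * d) + (b + j * d))
    balance = trans (cong (λ n → a + b + n * d + (b + i * d)) (sym (m+[n∸m]≡n (≤-trans j≤ℓ ℓ≤e))))
                    (regroup a b i j (e ∸ j) d)
      where
      regroup : ∀ a b i j r d → a + b + (j + r) * d + (b + i * d) ≡ (a + r * d) + ((b + i * d) + (b + j * d))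
      regroup = solve-∀

  reflect-P₁P₁ : ∀ {P T} → P ≤ k + k → T ≤ ℓ + ℓ →
    (a + a + P * d) + (b + b + T * d) ≡ c + t → b + b + T * d ∈ L
  reflect-P₁P₁ {P} {T} P≤ T≤ eq = P₁+P₂⊆L (subst (_∈ AP (a + b) d (k + ℓ)) (sym shifted) (∈-AP⁺ r≤))
    where
    -- s′ reaches a + b after e + k − P steps, with e + k − P ≤ k + ℓ: when
    -- a ≤ b (so e = ℓ) because P + T ≤ e + k, when b ≤ a because e + k − P ≤ T.
    steps : b + b + (P + T) * d ≡ a + b + (e + k) * d
    steps = +-cancelˡ-≡ (a + a) _ _ (trans (regroup₁ a b P T d) (trans eq (regroup₂ a b e k d)))
      where
      regroup₁ : ∀ a b P T d → a + a + (b + b + (P + T) * d) ≡ (a + a + P * d) + (b + b + T * d)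
      regroup₁ = solve-∀
      regroup₂ : ∀ a b e k d → (a + b + e * d) + (a + a + k * d) ≡ a + a + (a + b + (e + k) * d)
      regroup₂ = solve-∀
    P≤e+k : P ≤ e + k
    P≤e+k = by-order order
      where
      by-order : (a ≤ b × e ≤ ℓ) ⊎ (b ≤ a × k ≤ e) → P ≤ e + k
      by-order (inj₁ (a≤b , _)) = m+n≤o⇒m≤o P (index-≤ {m = e + k} {n = P + T} (+-monoˡ-≤ b a≤b) (sym steps))
      by-order (inj₂ (_ , k≤e)) = ≤-trans P≤ (+-monoˡ-≤ k k≤e)
    shifted : b + b + T * d ≡ a + b + (e + k ∸ P) * d
    shifted = drop-steps {P = P} {T = T} P≤e+k steps
    r≤ : e + k ∸ P ≤ k + ℓ
    r≤ = by-order order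
      where
      by-order : (a ≤ b × e ≤ ℓ) ⊎ (b ≤ a × k ≤ e) → e + k ∸ P ≤ k + ℓ
      by-order (inj₁ (_ , e≤ℓ)) =
        ≤-trans (m∸n≤m (e + k) P) (≤-trans (+-monoˡ-≤ k e≤ℓ) (≤-reflexive (+-comm ℓ k)))
      by-order (inj₂ (b≤a , _)) =
        ≤-trans (index-≤ {m = T} {n = e + k ∸ P} (+-monoˡ-≤ b b≤a) shifted) (≤-trans T≤ (+-monoˡ-≤ ℓ (≤-trans ℓ≤e e≤k)))

  reflect-P₁P₂ : ∀ {P T} → P ≤ k + ℓ →
    (a + b + P * d) + (b + b + T * d) ≡ c + t → b + b + T * d ∈ L
  reflect-P₁P₂ {P} {T} P≤ eq = P₁+P₁⊆L (subst (_∈ AP (a + a) d (k + k)) (sym shifted) (∈-AP⁺ r≤))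
    where
    -- s′ reaches a + a after e + k − P ≤ e + k ≤ k + k steps.
    steps : b + b + (P + T) * d ≡ a + a + (e + k) * d
    steps = +-cancelˡ-≡ (a + b) _ _ (trans (regroup₁ a b P T d) (trans eq (regroup₂ a b e k d)))
      where
      regroup₁ : ∀ a b P T d → a + b + (b + b + (P + T) * d) ≡ (a + b + P * d) + (b + b + T * d)
      regroup₁ = solve-∀
      regroup₂ : ∀ a b e k d → (a + b + e * d) + (a + a + k * d) ≡ a + b + (a + a + (e + k) * d)
      regroup₂ = solve-∀
    shifted : b + b + T * d ≡ a + a + (e + k ∸ P) * d
    shifted = drop-steps {P = P} {T = T} (≤-trans P≤ (≤-trans (+-monoʳ-≤ k ℓ≤e) (≤-reflexive (+-comm k e)))) steps
    r≤ : e + k ∸ P ≤ k + k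
    r≤ = ≤-trans (m∸n≤m (e + k) P) (+-monoˡ-≤ k e≤k)

  -- The images of the translation and of the reflection are disjoint.
  disjoint : ∀ {s s′} → s ∈ L → s′ ∈ cartesianProductWith _+_ P₂ P₂ → s + s′ ≡ c + t → s′ ∈ L
  disjoint s∈ s′∈ eq with T , T≤ , refl ← ∈-AP⁻ (P₂+P₂⊆AP s′∈) with L⊆P₁+A s∈
  ... | inj₁ s∈P₁P₁ with P , P≤ , refl ← ∈-AP⁻ s∈P₁P₁ = reflect-P₁P₁ P≤ T≤ eq
  ... | inj₂ s∈P₁P₂ with P , P≤ , refl ← ∈-AP⁻ s∈P₁P₂ = reflect-P₁P₂ {T = T} P≤ eq

  φ′ : (s : ℕ) → Dec (s ∈ L) → ℤ
  φ′ s (yes _) = + s - + t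
  φ′ s (no _)  = + c - + s

  φ : ℕ → ℤ
  φ s = φ′ s (s ∈? L)

  φ∈ : ∀ {s} → s ∈ sumset A → φ s ∈ diffset A
  φ∈ {s} s∈ with s ∈? L
  ... | yes s∈L = translate∈ s∈L
  ... | no  s∉L = reflect∈ (outside-L s∈ s∉L)

  φ-injective : InjectiveOn φ (sumset A)
  φ-injective {s} {s′} s∈ s′∈ eq with s ∈? L | s′ ∈? L
  ... | yes _   | yes _    = +-cancelʳ-≡ t s s′ (diff-≡⁻ s t s′ t eq)
  ... | no _    | no _     = sym (+-cancelˡ-≡ c s′ s (diff-≡⁻ c s c s′ eq))
  ... | yes s∈L | no s′∉L  = ⊥-elim (s′∉L (disjoint s∈L (outside-L s′∈ s′∉L) (diff-≡⁻ s t c s′ eq)))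
  ... | no s∉L  | yes s′∈L = ⊥-elim (s∉L (disjoint s′∈L (outside-L s∈ s∉L) (sym (diff-≡⁻ c s s′ t eq))))

  sum≤diff : cardℕ (sumset A) ≤ cardℤ (diffset A)
  sum≤diff = distinct-≤ ℕ._≟_ ℤ._≟_ φ φ-injective φ∈

sum≤diff-ordered : (d a b k ℓ : ℕ) → 1 ≤ d → ℓ ≤ k →
  cardℕ (sumset (AP a d k ++ AP b d ℓ)) ≤ cardℤ (diffset (AP a d k ++ AP b d ℓ))
sum≤diff-ordered d a b k ℓ d≥1 ℓ≤k with a ≤? b
... | yes a≤b = Injection.sum≤diff d a b k ℓ ℓ {{>-nonZero d≥1}} ≤-refl ℓ≤k (inj₁ (a≤b , ≤-refl))
... | no  a≰b = Injection.sum≤diff d a b k ℓ k {{>-nonZero d≥1}} ℓ≤k ≤-refl (inj₂ (≰⇒≥ a≰b , ≤-refl))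

sum≤diff : (d a b k ℓ : ℕ) → 1 ≤ d →
  cardℕ (sumset (AP a d k ++ AP b d ℓ)) ≤ cardℤ (diffset (AP a d k ++ AP b d ℓ))
sum≤diff d a b k ℓ d≥1 with ℓ ≤? k
... | yes ℓ≤k = sum≤diff-ordered d a b k ℓ d≥1 ℓ≤k
... | no  ℓ≰k = begin
  cardℕ (sumset (P ++ Q))   ≤⟨ cardℕ-mono (sumset-mono (⊆-reflexive-↭ (++-comm P Q))) ⟩
  cardℕ (sumset (Q ++ P))   ≤⟨ sum≤diff-ordered d b a ℓ k d≥1 (≰⇒≥ ℓ≰k) ⟩
  cardℤ (diffset (Q ++ P))  ≤⟨ cardℤ-mono (diffset-mono (⊆-reflexive-↭ (++-comm Q P))) ⟩
  cardℤ (diffset (P ++ Q))  ∎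
  where
  open ≤-Reasoning
  P Q : List ℕ
  P = AP a d k
  Q = AP b d ℓ

theorem1 : (d a b k ℓ : ℕ) → 1 ≤ d →
    ¬ SumDominant (AP a d k ++ AP b d ℓ) × cardℕ (sumset (AP a d k ++ AP b d ℓ)) ≤ cardℤ (diffset (AP a d k ++ AP b d ℓ))
theorem1 d a b k ℓ d≥1 = ≤⇒≯ (sum≤diff d a b k ℓ d≥1) , sum≤diff d a b k ℓ d≥1
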